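{- Every (simple undirected) graph that has a $2$-geodetic orientation is $K_4^-$-free, where $K_4^-$ is the complete graph on $4$ vertices with one edge deleted.
   Context: A digraph has a vertex set and an arc set consisting of ordered pairs of distinct vertices. A walk of length $\ell$ is a sequence $x_0x_1\dots x_\ell$ of vertices with $x_i \rightarrow x_{i+1}$ for all $i$. A digraph is $k$-geodetic if for every ordered pair $(u,v)$ of (not necessarily distinct) vertices there is at most one $u,v$-walk of length at most $k$. A graph $H$ has a $k$-geodetic orientation if each edge of $H$ can be given a direction so that the resulting digraph is $k$-geodetic. A graph is $F$-free if it contains no subgraph isomorphic to $F$. -}

module Defs where

open import Data.Nat using (ℕ; suc; _≤_)
open import Data.Fin using (Fin; zero; suc)
open import Data.List using (List; []; _∷_; length)
open import Data.Sum using (_⊎_)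
open import Data.Product using (Σ; _×_)
open import Function.Definitions using (Injective)
open import Relation.Nullary using (¬_)
open import Relation.Binary.PropositionalEquality using (_≡_)
open import Data.Empty using (⊥)
open import Data.Unit using (⊤)

record Graph (n : ℕ) : Set₁ where
  field
    Adj   : Fin n → Fin n → Set
    sym   : ∀ {x y} → Adj x y → Adj y x
    irrefl : ∀ {x} → ¬ Adj x x
open Graph public

Digraph : ℕ → Set₁
Digraph n = Fin n → Fin n → Set

-- A walk starting at x whose subsequent vertices are the given list:
-- x → y₁ → y₂ → … → y_ℓ ; its length is the length of the list.
data WalkFrom {n : ℕ} (A : Digraph n) : Fin n → List (Fin n) → Set where
  here : ∀ {x} → WalkFrom A x []
  step : ∀ {x y ys} → A x y → WalkFrom A y ys → WalkFrom A x (y ∷ ys)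

endpoint : ∀ {n} → Fin n → List (Fin n) → Fin n
endpoint x []       = x
endpoint x (y ∷ ys) = endpoint y ys

Geodetic : ∀ {n} → ℕ → Digraph n → Set
Geodetic {n} k A =
  ∀ (u v : Fin n) (ys zs : List (Fin n)) →
  WalkFrom A u ys → length ys ≤ k → endpoint u ys ≡ v →
  WalkFrom A u zs → length zs ≤ k → endpoint u zs ≡ v →
  ys ≡ zs

IsOrientation : ∀ {n} → Graph n → Digraph n → Set
IsOrientation {n} G A =
  (∀ x y → A x y → Adj G x y) ×
  (∀ x y → Adj G x y → A x y ⊎ A y x) ×
  (∀ x y → A x y → ¬ A y x)

HasGeodeticOrientation : ∀ {n} → ℕ → Graph n → Set₁
HasGeodeticOrientation {n} k G = Σ (Digraph n) λ A → IsOrientation G A × Geodetic k A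

ContainsSubgraph : ∀ {m n} → Graph n → Graph m → Set
ContainsSubgraph {m} {n} H F =
  Σ (Fin m → Fin n) λ f → Injective _≡_ _≡_ f ×
    (∀ x y → Adj F x y → Adj H (f x) (f y))

_-free : ∀ {m n} → Graph m → Graph n → Set
_-free F H = ¬ ContainsSubgraph H F

-- K₄⁻ on vertices 0,1,2,3: all edges except {2,3}.
private
  K4⁻adj : Fin 4 → Fin 4 → Set
  K4⁻adj zero zero = ⊥
  K4⁻adj zero (suc _) = ⊤
  K4⁻adj (suc _) zero = ⊤
  K4⁻adj (suc zero) (suc zero) = ⊥
  K4⁻adj (suc zero) (suc (suc _)) = ⊤
  K4⁻adj (suc (suc _)) (suc zero) = ⊤
  K4⁻adj (suc (suc _)) (suc (suc _)) = ⊥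

  K4⁻sym : ∀ {x y} → K4⁻adj x y → K4⁻adj y x
  K4⁻sym {zero} {zero} ()
  K4⁻sym {zero} {suc _} _ = _
  K4⁻sym {suc _} {zero} _ = _
  K4⁻sym {suc zero} {suc zero} ()
  K4⁻sym {suc zero} {suc (suc _)} _ = _
  K4⁻sym {suc (suc _)} {suc zero} _ = _
  K4⁻sym {suc (suc _)} {suc (suc _)} ()

  K4⁻irr : ∀ {x} → ¬ K4⁻adj x x
  K4⁻irr {zero} ()
  K4⁻irr {suc zero} ()
  K4⁻irr {suc (suc _)} ()

K4⁻ : Graph 4
K4⁻ = record { Adj = K4⁻adj ; sym = K4⁻sym ; irrefl = K4⁻irr }

{-# OPTIONS --safe #-}
module Submission where

open import Defs
open import Data.Nat using (ℕ; s≤s; z≤n)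
open import Data.Fin using (#_)
open import Data.List using (List; []; _∷_)
open import Data.Sum using (_⊎_; inj₁; inj₂)
open import Data.Product using (_×_; _,_)
open import Data.Unit using (tt)
open import Data.Empty using (⊥; ⊥-elim)
open import Relation.Binary.PropositionalEquality using (_≡_; refl)

-- In a 2-geodetic digraph no triangle is transitive, so a triangle containing
-- the arc x → y is the directed cycle x → y → z → x; its apex z is then the
-- midpoint of a 2-walk y → x, which is unique. The two triangles of K₄⁻
-- sharing the edge {0,1} would thus have the same apex.

module _ {n : ℕ} {A : Digraph n} (geo : Geodetic 2 A) where

  no-transitive-triangle : ∀ {x y z} → A x y → A y z → A x z → ⊥
  no-transitive-triangle {x} {y} {z} xy yz xz
    with geo x z (z ∷ []) (y ∷ z ∷ []) (step xz here) (s≤s z≤n) refl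
             (step xy (step yz here)) (s≤s (s≤s z≤n)) refl
  ... | ()

  2-walk-midpoint-unique : ∀ {x y c d} → A x c → A c y → A x d → A d y → c ≡ d
  2-walk-midpoint-unique {x} {y} {c} {d} xc cy xd dy
    with geo x y (c ∷ y ∷ []) (d ∷ y ∷ []) (step xc (step cy here)) (s≤s (s≤s z≤n)) refl
             (step xd (step dy here)) (s≤s (s≤s z≤n)) refl
  ... | refl = refl

  triangle-on-arc-is-cyclic : ∀ {x y z} → A x y → A y z ⊎ A z y → A z x ⊎ A x z →
                              A y z × A z x
  triangle-on-arc-is-cyclic xy (inj₁ yz) (inj₁ zx) = yz , zx
  triangle-on-arc-is-cyclic xy (inj₁ yz) (inj₂ xz) = ⊥-elim (no-transitive-triangle xy yz xz)
  triangle-on-arc-is-cyclic xy (inj₂ zy) (inj₁ zx) = ⊥-elim (no-transitive-triangle zx xy zy)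
  triangle-on-arc-is-cyclic xy (inj₂ zy) (inj₂ xz) = ⊥-elim (no-transitive-triangle xz zy xy)

  triangles-on-arc-share-apex : ∀ {x y c d} → A x y →
                                A y c ⊎ A c y → A c x ⊎ A x c →
                                A y d ⊎ A d y → A d x ⊎ A x d → c ≡ d
  triangles-on-arc-share-apex xy yc cx yd dx
    with triangle-on-arc-is-cyclic xy yc cx | triangle-on-arc-is-cyclic xy yd dx
  ... | yc′ , cx′ | yd′ , dx′ = 2-walk-midpoint-unique yc′ cx′ yd′ dx′

lemma9 : ∀ {n : ℕ} (H : Graph n) → HasGeodeticOrientation 2 H → (K4⁻ -free) H
lemma9 H (A , (_ , oriented , _) , geo) (f , f-injective , f-edge) =
  apices-distinct (common-apex (edge (# 0) (# 1) tt))
  where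
  edge : ∀ i j → Adj K4⁻ i j → A (f i) (f j) ⊎ A (f j) (f i)
  edge i j e = oriented _ _ (f-edge i j e)

  common-apex : A (f (# 0)) (f (# 1)) ⊎ A (f (# 1)) (f (# 0)) → f (# 2) ≡ f (# 3)
  common-apex (inj₁ ab) = triangles-on-arc-share-apex geo ab
    (edge (# 1) (# 2) tt) (edge (# 2) (# 0) tt) (edge (# 1) (# 3) tt) (edge (# 3) (# 0) tt)
  common-apex (inj₂ ba) = triangles-on-arc-share-apex geo ba
    (edge (# 0) (# 2) tt) (edge (# 2) (# 1) tt) (edge (# 0) (# 3) tt) (edge (# 3) (# 1) tt)

  apices-distinct : f (# 2) ≡ f (# 3) → ⊥
  apices-distinct p with f-injective p
  ... | ()
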